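{- Let $c$ be a one-hole configuration. Then either $c$ or its reverse $\overline{c}=(c_n,\dots,c_1)$ is weakly Łukasiewicz.
   Context: A configuration of size $n$ is a tuple $c=(c_1,\dots,c_n)$ of nonnegative integers with $\sum_i c_i=n$, viewed as $c_i$ balls at site $i\in\mathbb{Z}$. Writing $c=(0^k,\gamma,0^{n-s-k})$ uniquely with $\gamma=(\gamma_1,\dots,\gamma_s)$, $\gamma_1,\gamma_s>0$ ($0^k$ denoting $k$ zeros, juxtaposition concatenation), $\gamma$ is the core of $c$; $c$ is one-hole if $\gamma$ has exactly one zero entry. The left-to-right order of $c$ is the non-decreasing sequence listing each $i$ with multiplicity $c_i$. Fix real $q>0$. Random dynamic: balls are dropped onto $\mathbb{Z}$ one at a time from their sites; a ball landing on an occupied site moves one site left with probability $q/(1+q)$ and right with probability $1/(1+q)$, repeating until it reaches an unoccupied site, where it settles. A configuration $c$ is weakly Łukasiewicz if, when its balls are dropped in left-to-right order, in every run of the dynamic (with positive probability) in which all balls end in $[1;n]$, the set of occupied sites after each ball has settled is an interval. -}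

module Defs where

open import Data.Nat using (ℕ; zero; suc)
import Data.Nat as ℕ
open import Data.Integer using (ℤ; +_; _+_; _-_; _≤_)
open import Data.List using (List; []; _∷_; _++_; replicate; reverse; dropWhile; filter; length; take)
open import Data.Nat.ListAction using (sum)
open import Data.List.Membership.Propositional using (_∈_)
open import Data.List.Relation.Unary.All using (All)
open import Data.Product using (_×_)
open import Relation.Nullary using (¬_)
open import Relation.Binary.PropositionalEquality using (_≡_)

Config : Set
Config = List ℕ

IsConfig : Config → Set
IsConfig c = sum c ≡ length c

stripZeros : List ℕ → List ℕ
stripZeros = dropWhile (ℕ._≟ 0)

core : Config → List ℕ
core c = reverse (stripZeros (reverse (stripZeros c)))

OneHole : Config → Set
OneHole c = length (filter (ℕ._≟ 0) (core c)) ≡ 1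

orderFrom : ℕ → Config → List ℤ
orderFrom k []       = []
orderFrom k (x ∷ xs) = replicate x (+ k) ++ orderFrom (suc k) xs

ltrOrder : Config → List ℤ
ltrOrder c = orderFrom 1 c

-- Lands S i j : a ball dropped at site i onto the occupied set S can
-- (by a finite sequence of left/right moves, each with positive probability
-- since q > 0) settle at site j.
data Lands (S : List ℤ) : ℤ → ℤ → Set where
  settle : ∀ {i} → ¬ (i ∈ S) → Lands S i i
  left   : ∀ {i j} → i ∈ S → Lands S (i - + 1) j → Lands S i j
  right  : ∀ {i j} → i ∈ S → Lands S (i + + 1) j → Lands S i j

data Run : List ℤ → List ℤ → List ℤ → Set where
  done : ∀ {S} → Run S [] []
  step : ∀ {S i is j js} → Lands S i j → Run (j ∷ S) is js → Run S (i ∷ is) (j ∷ js)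

IsInterval : List ℤ → Set
IsInterval S = ∀ {a b x} → a ∈ S → b ∈ S → a ≤ x → x ≤ b → x ∈ S

-- Weakly Łukasiewicz: in every run of the dynamic (balls dropped in
-- left-to-right order) in which all balls end in [1; n], the occupied set
-- after each ball has settled (the first k landing sites) is an interval.
WeaklyLukasiewicz : Config → Set
WeaklyLukasiewicz c =
  ∀ (js : List ℤ) → Run [] (ltrOrder c) js →
  All (λ j → (+ 1 ≤ j) × (j ≤ + length c)) js →
  ∀ (k : ℕ) → IsInterval (take k js)

{-# OPTIONS --safe #-}
module Submission where

-- Write c = 0ᵏ L 0 R 0ʳ with L and R free of zeros. As c has as many balls as sites, either L
-- carries more than k + |L| balls or R carries more than r + |R|; up to reversal, the former.
-- Drop the balls left to right. In a run staying in [1; n], the t balls dropped so far occupy an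
-- interval [a, b] with a ≥ 1, hence b ≥ t, and the next ball starts at most one site right of the
-- previous ball or at a site ≤ t + 1 (the one gap, at the hole, is reached after more than k + |L|
-- balls). So it starts in [a - 1, b + 1], and from there it can only settle at a - 1 or b + 1: the
-- occupied set stays an interval.

open import Defs
open import Data.Nat as ℕ using (ℕ; zero; suc; z≤n; s≤s)
import Data.Nat.Properties as ℕ
open import Data.Nat.Tactic.RingSolver using () renaming (solve-∀ to ℕ-solve-∀)
open import Data.Integer using (ℤ; +_; +≤+; +<+; _≤_; _<_; _+_; -_; pred; 1ℤ; -1ℤ)
  renaming (suc to sucℤ)
open import Data.Integer.Properties
  using (≤-refl; ≤-trans; ≤-antisym; _≤?_; ≰⇒>; <⇒≱; +-comm; +-identityʳ; +-monoˡ-≤; i≤i+j; i-j≤i;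
         suc-mono; pred-mono; i≤suc[i]; i≤j⇒i≤1+j; i≤j⇒pred[i]≤j; i<j⇒suc[i]≤j; i<j⇒i≤pred[j])
open import Data.Integer.Tactic.RingSolver using (solve-∀)
open import Data.List using (List; []; _∷_; _++_; [_]; _∷ʳ_; replicate; reverse; filter; length; take)
open import Data.List.Properties
  using (++-assoc; ++-identityʳ; reverse-++; unfold-reverse; reverse-involutive;
         length-++; length-replicate; length-reverse)
open import Data.Nat.ListAction using (sum)
open import Data.Nat.ListAction.Properties using (sum-++; sum-↭)
open import Data.List.Membership.Propositional using (_∈_)
open import Data.List.Relation.Unary.Any using (here; there)
open import Data.List.Relation.Unary.All as All using (All; []; _∷_)
open import Data.List.Relation.Binary.Permutation.Propositional using (_↭_; ↭-sym)
open import Data.List.Relation.Binary.Permutation.Propositional.Properties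
  using (∈-resp-↭; All-resp-↭; shift; ↭-reverse)
open import Data.Product as Product using (_×_; _,_; proj₁; proj₂; ∃-syntax)
open import Data.Sum as Sum using (_⊎_; inj₁; inj₂)
open import Relation.Binary.Definitions using (_Respects_)
open import Relation.Nullary using (yes; no; contradiction)
open import Relation.Binary.PropositionalEquality
  using (_≡_; refl; sym; trans; cong; cong₂; subst; subst₂; module ≡-Reasoning)

private variable
  a b i j p q prev : ℤ
  S ps js : List ℤ
  t : ℕ
  L R : List ℕ

pred[i]≤j⇒j≡pred[i]⊎i≤j : pred i ≤ j → j ≡ pred i ⊎ i ≤ j
pred[i]≤j⇒j≡pred[i]⊎i≤j {i} {j} pred[i]≤j with i ≤? j
... | yes i≤j = inj₂ i≤j
... | no  i≰j = inj₁ (≤-antisym (i<j⇒i≤pred[j] (≰⇒> i≰j)) pred[i]≤j)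

i≤suc[j]⇒i≡suc[j]⊎i≤j : i ≤ sucℤ j → i ≡ sucℤ j ⊎ i ≤ j
i≤suc[j]⇒i≡suc[j]⊎i≤j {i} {j} i≤suc[j] with i ≤? j
... | yes i≤j = inj₂ i≤j
... | no  i≰j = inj₁ (≤-antisym i≤suc[j] (i<j⇒suc[i]≤j (≰⇒> i≰j)))

record Spans (S : List ℤ) (a b : ℤ) : Set where
  field
    bounded : ∀ {x} → x ∈ S → a ≤ x × x ≤ b
    filled  : ∀ {x} → a ≤ x → x ≤ b → x ∈ S

open Spans

Spans⇒IsInterval : Spans S a b → IsInterval S
Spans⇒IsInterval S≐[a,b] u∈S v∈S u≤x x≤v =
  filled S≐[a,b] (≤-trans (proj₁ (bounded S≐[a,b] u∈S)) u≤x) (≤-trans x≤v (proj₂ (bounded S≐[a,b] v∈S)))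

IsInterval-resp-↭ : IsInterval Respects _↭_
IsInterval-resp-↭ S↭S′ S-interval u∈S′ v∈S′ u≤x x≤v =
  ∈-resp-↭ S↭S′ (S-interval (∈-resp-↭ (↭-sym S↭S′) u∈S′) (∈-resp-↭ (↭-sym S↭S′) v∈S′) u≤x x≤v)

spans-[] : b < a → Spans [] a b
bounded (spans-[] _) ()
filled  (spans-[] b<a) a≤x x≤b = contradiction (≤-trans a≤x x≤b) (<⇒≱ b<a)

spans-extendˡ : Spans S a b → pred a ≤ b → Spans (pred a ∷ S) (pred a) b
bounded (spans-extendˡ _ pred[a]≤b) (here refl) = ≤-refl , pred[a]≤b
bounded (spans-extendˡ S≐[a,b] _) (there x∈S) = Product.map₁ i≤j⇒pred[i]≤j (bounded S≐[a,b] x∈S)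
filled  (spans-extendˡ {a = a} S≐[a,b] _) pred[a]≤x x≤b with pred[i]≤j⇒j≡pred[i]⊎i≤j {a} pred[a]≤x
... | inj₁ refl = here refl
... | inj₂ a≤x  = there (filled S≐[a,b] a≤x x≤b)

spans-extendʳ : Spans S a b → a ≤ sucℤ b → Spans (sucℤ b ∷ S) a (sucℤ b)
bounded (spans-extendʳ _ a≤suc[b]) (here refl) = a≤suc[b] , ≤-refl
bounded (spans-extendʳ S≐[a,b] _) (there x∈S) = Product.map₂ i≤j⇒i≤1+j (bounded S≐[a,b] x∈S)
filled  (spans-extendʳ {b = b} S≐[a,b] _) a≤x x≤suc[b] with i≤suc[j]⇒i≡suc[j]⊎i≤j {j = b} x≤suc[b]
... | inj₁ refl = here refl
... | inj₂ x≤b  = there (filled S≐[a,b] a≤x x≤b)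

lands⇒start∈ : Lands S i j → i ∈ j ∷ S
lands⇒start∈ (settle _)    = here refl
lands⇒start∈ (left  i∈S _) = there i∈S
lands⇒start∈ (right i∈S _) = there i∈S

lands-beside : Spans S a b → Lands S i j → pred a ≤ i → i ≤ sucℤ b → j ≡ pred a ⊎ j ≡ sucℤ b
lands-beside S≐[a,b] (settle i∉S) pred[a]≤i i≤suc[b]
  with pred[i]≤j⇒j≡pred[i]⊎i≤j pred[a]≤i | i≤suc[j]⇒i≡suc[j]⊎i≤j i≤suc[b]
... | inj₁ i≡pred[a] | _             = inj₁ i≡pred[a]
... | inj₂ _         | inj₁ i≡suc[b] = inj₂ i≡suc[b]
... | inj₂ a≤i       | inj₂ i≤b      = contradiction (filled S≐[a,b] a≤i i≤b) i∉S
lands-beside {a = a} S≐[a,b] (left {i} i∈S lands) _ _ with bounded S≐[a,b] i∈S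
... | a≤i , i≤b = lands-beside S≐[a,b] lands (subst (pred a ≤_) (+-comm -1ℤ i) (pred-mono a≤i))
                                             (≤-trans (i-j≤i i (+ 1)) (i≤j⇒i≤1+j i≤b))
lands-beside {b = b} S≐[a,b] (right {i} i∈S lands) _ _ with bounded S≐[a,b] i∈S
... | a≤i , i≤b = lands-beside S≐[a,b] lands (≤-trans (i≤j⇒pred[i]≤j a≤i) (i≤i+j i (+ 1)))
                                             (subst (_≤ sucℤ b) (+-comm 1ℤ i) (suc-mono i≤b))

-- The t balls dropped so far, the last one from site prev, occupy S = [lo, hi] ⊆ [1, ∞).
record Packed (t : ℕ) (prev : ℤ) (S : List ℤ) : Set where
  field
    lo hi      : ℤ
    spans      : Spans S lo hi
    positive   : + 1 ≤ lo
    size       : sucℤ hi ≡ lo + + t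
    prev-lower : pred lo ≤ prev
    prev-upper : prev ≤ hi

packed : Spans S a b → + 1 ≤ a → sucℤ b ≡ a + + t → p ∈ S → Packed t p S
packed {a = a} {b} S≐[a,b] 1≤a size p∈S = record
  { lo = a ; hi = b ; spans = S≐[a,b] ; positive = 1≤a ; size = size
  ; prev-lower = i≤j⇒pred[i]≤j (proj₁ (bounded S≐[a,b] p∈S))
  ; prev-upper = proj₂ (bounded S≐[a,b] p∈S)
  }

-- The empty interval [k + 1, k], with a fictitious previous ball at site k.
packed-start : ∀ k → Packed 0 (+ k) []
packed-start k = record
  { lo = + suc k ; hi = + k ; spans = spans-[] (+<+ ℕ.≤-refl) ; positive = +≤+ (s≤s z≤n)
  ; size = sym (+-identityʳ (+ suc k)) ; prev-lower = ≤-refl ; prev-upper = ≤-refl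
  }

grow-left : ∀ a t → a + t ≡ (- + 1 + a) + (+ 1 + t)
grow-left = solve-∀

grow-right : ∀ a t → + 1 + (a + t) ≡ a + (+ 1 + t)
grow-right = solve-∀

packed-step : Packed t prev S → prev ≤ p → p ≤ sucℤ prev ⊎ p ≤ + suc t → Lands S p j → + 1 ≤ j →
  Packed (suc t) p (j ∷ S)
packed-step {t = t} {prev = prev} {S = S} {p = p} st prev≤p near lands =
  extend (lands⇒start∈ lands) (lands-beside spans lands (≤-trans prev-lower prev≤p) (p≤suc[hi] near))
  where
  open Packed st

  p≤suc[hi] : p ≤ sucℤ prev ⊎ p ≤ + suc t → p ≤ sucℤ hi
  p≤suc[hi] (inj₁ p≤suc[prev]) = ≤-trans p≤suc[prev] (suc-mono prev-upper)
  p≤suc[hi] (inj₂ p≤suc[t])    = ≤-trans p≤suc[t] (subst (+ suc t ≤_) (sym size) (+-monoˡ-≤ (+ t) positive))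

  extend : ∀ {j} → p ∈ j ∷ S → j ≡ pred lo ⊎ j ≡ sucℤ hi → + 1 ≤ j → Packed (suc t) p (j ∷ S)
  extend p∈ (inj₁ refl) 1≤j =
    packed (spans-extendˡ spans (≤-trans prev-lower prev-upper)) 1≤j (trans size (grow-left lo (+ t))) p∈
  extend p∈ (inj₂ refl) _ =
    packed (spans-extendʳ spans (subst (lo ≤_) (sym size) (i≤i+j lo (+ t)))) positive
           (trans (cong sucℤ size) (grow-right lo (+ t))) p∈

-- Drop sites following t balls, the last one dropped from prev. A site more than one right of prev
-- is allowed only up to t + 1, which the occupied interval of Packed t prev S always reaches.
data NoEarlyGap (t : ℕ) (prev : ℤ) : List ℤ → Set where
  []   : NoEarlyGap t prev []
  next : prev ≤ p → p ≤ sucℤ prev ⊎ p ≤ + suc t → NoEarlyGap (suc t) p ps → NoEarlyGap t prev (p ∷ ps)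

run-interval : Packed t prev S → NoEarlyGap t prev ps → Run S ps js → All (+ 1 ≤_) js →
  ∀ k → IsInterval (take k js ++ S)
run-interval st _ _    _ zero    = Spans⇒IsInterval (Packed.spans st)
run-interval st _ done _ (suc k) = Spans⇒IsInterval (Packed.spans st)
run-interval {S = S} st (next prev≤p near gaps) (step {j = j} {js = js} lands run) (1≤j ∷ 1≤js) (suc k) =
  IsInterval-resp-↭ (shift j (take k js) S) (run-interval (packed-step st prev≤p near lands 1≤j) gaps run 1≤js k)

zeros : ℕ → List ℕ
zeros n = replicate n 0

holed : ℕ → List ℕ → List ℕ → ℕ → Config
holed k L R r = zeros k ++ L ++ 0 ∷ R ++ zeros r

cast-count : ∀ {t′} → t ≡ t′ → NoEarlyGap t q ps → NoEarlyGap t′ q ps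
cast-count refl gaps = gaps

noEarlyGap-zeros : ∀ r s → NoEarlyGap t q (orderFrom s (zeros r))
noEarlyGap-zeros zero    s = []
noEarlyGap-zeros (suc r) s = noEarlyGap-zeros r (suc s)

noEarlyGap-replicate : ∀ x → NoEarlyGap (t ℕ.+ x) q ps → NoEarlyGap t q (replicate x q ++ ps)
noEarlyGap-replicate {t} zero    gaps = cast-count (ℕ.+-identityʳ t) gaps
noEarlyGap-replicate {t} (suc x) gaps =
  next ≤-refl (inj₁ (i≤suc[i] _)) (noEarlyGap-replicate x (cast-count (ℕ.+-suc t x) gaps))

noEarlyGap-site : ∀ {p s x} xs → p ℕ.≤ s → s ℕ.≤ suc p ⊎ s ℕ.≤ suc t →
  NoEarlyGap (t ℕ.+ suc x) (+ s) (orderFrom (suc s) xs) → NoEarlyGap t (+ p) (orderFrom s (suc x ∷ xs))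
noEarlyGap-site {t} {x = x} _ p≤s near gaps =
  next (+≤+ p≤s) (Sum.map +≤+ +≤+ near) (noEarlyGap-replicate x (cast-count (ℕ.+-suc t x) gaps))

noEarlyGap-block : ∀ {p} xs → All (0 ℕ.<_) L →
  NoEarlyGap (t ℕ.+ sum L) (+ (p ℕ.+ length L)) (orderFrom (suc p ℕ.+ length L) xs) →
  NoEarlyGap t (+ p) (orderFrom (suc p) (L ++ xs))
noEarlyGap-block {t = t} {p} xs [] gaps =
  subst₂ (λ t′ p′ → NoEarlyGap t′ (+ p′) (orderFrom (suc p′) xs)) (ℕ.+-identityʳ t) (ℕ.+-identityʳ p) gaps
noEarlyGap-block {suc y ∷ L} {t} {p} xs (_ ∷ L>0) gaps =
  noEarlyGap-site (L ++ xs) (ℕ.n≤1+n p) (inj₁ ℕ.≤-refl) (noEarlyGap-block xs L>0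
    (subst₂ (λ t′ p′ → NoEarlyGap t′ (+ p′) (orderFrom (suc p′) xs))
            (sym (ℕ.+-assoc t (suc y) (sum L))) (ℕ.+-suc p (length L)) gaps))

noEarlyGap-hole : ∀ {P T} r → All (0 ℕ.<_) R → P ℕ.< T →
  NoEarlyGap T (+ P) (orderFrom (suc P) (0 ∷ R ++ zeros r))
noEarlyGap-hole r [] _ = noEarlyGap-zeros r _
noEarlyGap-hole {R = _ ∷ R} {P = P} r (s≤s _ ∷ R>0) P<T =
  noEarlyGap-site (R ++ zeros r) (ℕ.m≤n+m P 2) (inj₂ (s≤s P<T))
    (noEarlyGap-block (zeros r) R>0 (noEarlyGap-zeros r _))

orderFrom-zeros++ : ∀ k s xs → orderFrom s (zeros k ++ xs) ≡ orderFrom (s ℕ.+ k) xs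
orderFrom-zeros++ zero    s xs = cong (λ s′ → orderFrom s′ xs) (sym (ℕ.+-identityʳ s))
orderFrom-zeros++ (suc k) s xs =
  trans (orderFrom-zeros++ k (suc s) xs) (cong (λ s′ → orderFrom s′ xs) (sym (ℕ.+-suc s k)))

holed-noEarlyGap : ∀ {k} r → All (0 ℕ.<_) L → All (0 ℕ.<_) R → k ℕ.+ length L ℕ.< sum L →
  NoEarlyGap 0 (+ k) (ltrOrder (holed k L R r))
holed-noEarlyGap {L = L} {R} {k} r L>0 R>0 heavy =
  subst (NoEarlyGap 0 (+ k)) (sym (orderFrom-zeros++ k 1 (L ++ 0 ∷ R ++ zeros r)))
    (noEarlyGap-block (0 ∷ R ++ zeros r) L>0 (noEarlyGap-hole r R>0 heavy))

holed-weaklyLukasiewicz : ∀ {k} r → All (0 ℕ.<_) L → All (0 ℕ.<_) R → k ℕ.+ length L ℕ.< sum L →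
  WeaklyLukasiewicz (holed k L R r)
holed-weaklyLukasiewicz {k = k} r L>0 R>0 heavy js run in-range n =
  subst IsInterval (++-identityʳ (take n js))
    (run-interval (packed-start k) (holed-noEarlyGap r L>0 R>0 heavy) run (All.map proj₁ in-range) n)

replicate-∷ʳ : ∀ {A : Set} n (x : A) → replicate n x ∷ʳ x ≡ x ∷ replicate n x
replicate-∷ʳ zero    x = refl
replicate-∷ʳ (suc n) x = cong (x ∷_) (replicate-∷ʳ n x)

reverse-replicate : ∀ {A : Set} n (x : A) → reverse (replicate n x) ≡ replicate n x
reverse-replicate zero    x = refl
reverse-replicate (suc n) x = begin
  reverse (x ∷ replicate n x)  ≡⟨ unfold-reverse x (replicate n x) ⟩
  reverse (replicate n x) ∷ʳ x ≡⟨ cong (_∷ʳ x) (reverse-replicate n x) ⟩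
  replicate n x ∷ʳ x           ≡⟨ replicate-∷ʳ n x ⟩
  x ∷ replicate n x            ∎
  where open ≡-Reasoning

stripZeros-split : ∀ xs → ∃[ k ] xs ≡ zeros k ++ stripZeros xs
stripZeros-split []           = 0 , refl
stripZeros-split (zero ∷ xs)  = Product.map suc (cong (0 ∷_)) (stripZeros-split xs)
stripZeros-split (suc _ ∷ xs) = 0 , refl

noZero⇒positive : ∀ xs → length (filter (ℕ._≟ 0) xs) ≡ 0 → All (0 ℕ.<_) xs
noZero⇒positive []           _       = []
noZero⇒positive (zero ∷ _)   ()
noZero⇒positive (suc _ ∷ xs) no-zero = s≤s z≤n ∷ noZero⇒positive xs no-zero

oneZero⇒split : ∀ xs → length (filter (ℕ._≟ 0) xs) ≡ 1 →
  ∃[ L ] ∃[ R ] xs ≡ L ++ 0 ∷ R × All (0 ℕ.<_) L × All (0 ℕ.<_) R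
oneZero⇒split []           ()
oneZero⇒split (zero ∷ xs)  one-zero = [] , xs , refl , [] , noZero⇒positive xs (ℕ.suc-injective one-zero)
oneZero⇒split (suc x ∷ xs) one-zero with oneZero⇒split xs one-zero
... | L , R , refl , L>0 , R>0 = suc x ∷ L , R , refl , s≤s z≤n ∷ L>0 , R>0

oneHole⇒holed : ∀ c → OneHole c →
  ∃[ k ] ∃[ L ] ∃[ R ] ∃[ r ] c ≡ holed k L R r × All (0 ℕ.<_) L × All (0 ℕ.<_) R
oneHole⇒holed c one-hole with stripZeros-split c | stripZeros-split (reverse (stripZeros c))
                            | oneZero⇒split (core c) one-hole
... | k , c≡0ᵏd | r , reverse[d]≡0ʳe | L , R , reverse[e]≡L0R , L>0 , R>0 =
  k , L , R , r , c≡holed , L>0 , R>0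
  where
  open ≡-Reasoning
  d = stripZeros c
  e = stripZeros (reverse d)
  c≡holed : c ≡ holed k L R r
  c≡holed = begin
    c                                         ≡⟨ c≡0ᵏd ⟩
    zeros k ++ d                              ≡⟨ cong (zeros k ++_) (sym (reverse-involutive d)) ⟩
    zeros k ++ reverse (reverse d)            ≡⟨ cong (λ ds → zeros k ++ reverse ds) reverse[d]≡0ʳe ⟩
    zeros k ++ reverse (zeros r ++ e)         ≡⟨ cong (zeros k ++_) (reverse-++ (zeros r) e) ⟩
    zeros k ++ reverse e ++ reverse (zeros r)
      ≡⟨ cong₂ (λ ds zs → zeros k ++ ds ++ zs) reverse[e]≡L0R (reverse-replicate r 0) ⟩
    zeros k ++ (L ++ 0 ∷ R) ++ zeros r        ≡⟨ cong (zeros k ++_) (++-assoc L (0 ∷ R) (zeros r)) ⟩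
    holed k L R r                             ∎

reverse-holed : ∀ k L R r → reverse (holed k L R r) ≡ holed r (reverse R) (reverse L) k
reverse-holed k L R r = begin
  reverse (zeros k ++ L ++ 0 ∷ R ++ zeros r)
    ≡⟨ reverse-++ (zeros k) (L ++ 0 ∷ R ++ zeros r) ⟩
  reverse (L ++ 0 ∷ R ++ zeros r) ++ reverse (zeros k)
    ≡⟨ cong₂ _++_ (reverse-++ L (0 ∷ R ++ zeros r)) (reverse-replicate k 0) ⟩
  (reverse (0 ∷ R ++ zeros r) ++ reverse L) ++ zeros k
    ≡⟨ ++-assoc (reverse (0 ∷ R ++ zeros r)) (reverse L) (zeros k) ⟩
  reverse (0 ∷ R ++ zeros r) ++ reverse L ++ zeros k
    ≡⟨ cong (_++ reverse L ++ zeros k) (unfold-reverse 0 (R ++ zeros r)) ⟩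
  (reverse (R ++ zeros r) ∷ʳ 0) ++ reverse L ++ zeros k
    ≡⟨ ++-assoc (reverse (R ++ zeros r)) [ 0 ] (reverse L ++ zeros k) ⟩
  reverse (R ++ zeros r) ++ 0 ∷ reverse L ++ zeros k
    ≡⟨ cong (_++ 0 ∷ reverse L ++ zeros k) (reverse-++ R (zeros r)) ⟩
  (reverse (zeros r) ++ reverse R) ++ 0 ∷ reverse L ++ zeros k
    ≡⟨ ++-assoc (reverse (zeros r)) (reverse R) (0 ∷ reverse L ++ zeros k) ⟩
  reverse (zeros r) ++ reverse R ++ 0 ∷ reverse L ++ zeros k
    ≡⟨ cong (_++ reverse R ++ 0 ∷ reverse L ++ zeros k) (reverse-replicate r 0) ⟩
  zeros r ++ reverse R ++ 0 ∷ reverse L ++ zeros k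
    ∎
  where open ≡-Reasoning

sum-zeros : ∀ n → sum (zeros n) ≡ 0
sum-zeros zero    = refl
sum-zeros (suc n) = sum-zeros n

sum-holed : ∀ k L R r → sum (holed k L R r) ≡ sum L ℕ.+ sum R
sum-holed k L R r = begin
  sum (zeros k ++ L ++ 0 ∷ R ++ zeros r)        ≡⟨ sum-++ (zeros k) (L ++ 0 ∷ R ++ zeros r) ⟩
  sum (zeros k) ℕ.+ sum (L ++ 0 ∷ R ++ zeros r) ≡⟨ cong₂ ℕ._+_ (sum-zeros k) (sum-++ L (0 ∷ R ++ zeros r)) ⟩
  sum L ℕ.+ sum (R ++ zeros r)                  ≡⟨ cong (sum L ℕ.+_) (sum-++ R (zeros r)) ⟩
  sum L ℕ.+ (sum R ℕ.+ sum (zeros r))           ≡⟨ cong (λ z → sum L ℕ.+ (sum R ℕ.+ z)) (sum-zeros r) ⟩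
  sum L ℕ.+ (sum R ℕ.+ 0)                       ≡⟨ cong (sum L ℕ.+_) (ℕ.+-identityʳ (sum R)) ⟩
  sum L ℕ.+ sum R                               ∎
  where open ≡-Reasoning

length-holed : ∀ k L R r → length (holed k L R r) ≡ k ℕ.+ (length L ℕ.+ suc (length R ℕ.+ r))
length-holed k L R r = begin
  length (zeros k ++ L ++ 0 ∷ R ++ zeros r)
    ≡⟨ length-++ (zeros k) ⟩
  length (zeros k) ℕ.+ length (L ++ 0 ∷ R ++ zeros r)
    ≡⟨ cong₂ ℕ._+_ (length-replicate k) (length-++ L) ⟩
  k ℕ.+ (length L ℕ.+ suc (length (R ++ zeros r)))
    ≡⟨ cong (λ m → k ℕ.+ (length L ℕ.+ suc m)) (length-++ R) ⟩
  k ℕ.+ (length L ℕ.+ suc (length R ℕ.+ length (zeros r)))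
    ≡⟨ cong (λ m → k ℕ.+ (length L ℕ.+ suc (length R ℕ.+ m))) (length-replicate r) ⟩
  k ℕ.+ (length L ℕ.+ suc (length R ℕ.+ r))
    ∎
  where open ≡-Reasoning

lighter-left⇒heavier-right : ∀ k L R r → IsConfig (holed k L R r) → sum L ℕ.≤ k ℕ.+ length L →
  r ℕ.+ length R ℕ.< sum R
lighter-left⇒heavier-right k L R r is-config light = ℕ.+-cancelˡ-≤ (sum L) _ _ (begin
  sum L ℕ.+ suc (r ℕ.+ length R)            ≤⟨ ℕ.+-monoˡ-≤ _ light ⟩
  k ℕ.+ length L ℕ.+ suc (r ℕ.+ length R)   ≡⟨ rearrange k (length L) (length R) r ⟩
  k ℕ.+ (length L ℕ.+ suc (length R ℕ.+ r)) ≡⟨ sym (length-holed k L R r) ⟩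
  length (holed k L R r)                    ≡⟨ sym is-config ⟩
  sum (holed k L R r)                       ≡⟨ sum-holed k L R r ⟩
  sum L ℕ.+ sum R                           ∎)
  where
  open ℕ.≤-Reasoning
  rearrange : ∀ a b c d → a ℕ.+ b ℕ.+ suc (d ℕ.+ c) ≡ a ℕ.+ (b ℕ.+ suc (c ℕ.+ d))
  rearrange = ℕ-solve-∀

All-reverse : ∀ {P : ℕ → Set} {xs} → All P xs → All P (reverse xs)
All-reverse {xs = xs} = All-resp-↭ (↭-sym (↭-reverse xs))

proposition6p4 : ∀ (c : Config) → IsConfig c → OneHole c →
    WeaklyLukasiewicz c ⊎ WeaklyLukasiewicz (reverse c)
proposition6p4 c is-config one-hole with oneHole⇒holed c one-hole
... | k , L , R , r , refl , L>0 , R>0 with k ℕ.+ length L ℕ.<? sum L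
... | yes heavy-left = inj₁ (holed-weaklyLukasiewicz r L>0 R>0 heavy-left)
... | no  light-left = inj₂ (subst WeaklyLukasiewicz (sym (reverse-holed k L R r))
                              (holed-weaklyLukasiewicz k (All-reverse R>0) (All-reverse L>0) heavy-right))
  where
  heavy-right : r ℕ.+ length (reverse R) ℕ.< sum (reverse R)
  heavy-right rewrite length-reverse R | sum-↭ (↭-reverse R) =
    lighter-left⇒heavier-right k L R r is-config (ℕ.≮⇒≥ light-left)
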